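{- Define the Bell polynomials of the second kind $\mathrm{bel}_n(x)$ ($n\ge1$) by \[ \log\big(1+x\log(1+t)\big)=\sum_{n=1}^{\infty}\mathrm{bel}_{n}(x)\frac{t^{n}}{n!}, \] and set $\mathrm{bel}_n=\mathrm{bel}_n(1)$. Then for every $n\ge 1$, \[ x^{n}=\frac{(-1)^{n-1}}{(n-1)!}\sum_{k=1}^{n}\mathrm{bel}_{k}(x)S_{2}(n,k). \] In particular, \[ 1=\frac{(-1)^{n-1}}{(n-1)!}\sum_{k=1}^{n}\mathrm{bel}_{k}S_{2}(n,k). \]
   Context: The Stirling numbers of the second kind are given by $\frac{1}{k!}(e^t-1)^k=\sum_{n\ge k}S_2(n,k)\frac{t^n}{n!}$. All series are formal power series. -}

module Defs where

open import Data.Nat as ℕ using (ℕ; zero; suc; _∸_; _!)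
open import Data.Nat.Properties using (_!≢0)
open import Data.Integer as ℤ using (ℤ; +_)
open import Data.Rational using (ℚ; 0ℚ; 1ℚ; _+_; _*_; -_; _/_)

-- Formal power series over ℚ in the variable t, represented by their
-- coefficient sequences:  f = Σ_n f n · t^n.
Series : Set
Series = ℕ → ℚ

infixr 8 _^ℚ_
_^ℚ_ : ℚ → ℕ → ℚ
q ^ℚ zero  = 1ℚ
q ^ℚ suc n = q * (q ^ℚ n)

sgn : ℕ → ℚ
sgn n = (- 1ℚ) ^ℚ n

Σ0 : ℕ → (ℕ → ℚ) → ℚ
Σ0 zero    f = f 0
Σ0 (suc n) f = Σ0 n f + f (suc n)

Σ1 : ℕ → (ℕ → ℚ) → ℚ
Σ1 zero    f = 0ℚ
Σ1 (suc n) f = Σ1 n f + f (suc n)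

inv! : ℕ → ℚ
inv! n = (+ 1 / (n !)) {{n !≢0}}

fact : ℕ → ℚ
fact n = + (n !) / 1

_⊛_ : Series → Series → Series
(f ⊛ g) n = Σ0 n (λ i → f i * g (n ∸ i))

one : Series
one zero    = 1ℚ
one (suc n) = 0ℚ

pow : Series → ℕ → Series
pow f zero    = one
pow f (suc k) = f ⊛ pow f k

scale : ℚ → Series → Series
scale c f n = c * f n

-- 1/m for m ≥ 1 (only ever used at m ≥ 1; the value at 0 is irrelevant)
recip : ℕ → ℚ
recip zero    = 0ℚ
recip (suc m) = + 1 / suc m

log1+t : Series
log1+t zero    = 0ℚ
log1+t (suc n) = sgn n * recip (suc n)

-- Formal composition log(1+u) = Σ_{m≥1} (-1)^{m-1} u^m / m, for a series u
-- with zero constant term (then u^m has order ≥ m, so the coefficient of t^n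
-- only involves m ≤ n and the truncated sum below is exact).
log1+ : Series → Series
log1+ u n = Σ1 n (λ m → sgn (m ∸ 1) * recip m * pow u m n)

expm1 : Series
expm1 zero    = 0ℚ
expm1 (suc n) = inv! (suc n)

bel : ℕ → ℚ → ℚ
bel n x = fact n * log1+ (scale x log1+t) n

-- Stirling numbers of the second kind via
--   (1/k!) (e^t - 1)^k = Σ_{n≥k} S₂ n k · t^n / n!
S₂ : ℕ → ℕ → ℚ
S₂ n k = fact n * (inv! k * pow expm1 k n)

{-# OPTIONS --safe #-}
-- Write ℓ = log(1+t) and ε = e^t − 1. Since (1+t)ℓ′ = 1 and ε′ = 1 + ε, the
-- composites F_m = ℓ^m ∘ ε satisfy F_m′ = m F_{m−1}; with F_0 = 1 this gives
-- [t^n]F_m = Σ_k [t^k]ℓ^m · [t^n]ε^k = δ_{mn} for m ≤ n. Expanding bel_k(x) in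
-- the powers of ℓ and S₂(n,k) in the powers of ε, the sum Σ_k bel_k(x) S₂(n,k)
-- collapses to n! times the coefficient (−1)^{n−1} x^n / n of u^n in log(1 + x u).
module Submission where

open import Defs
open import Data.Nat using (ℕ; _≤_; _∸_)
open import Data.Rational using (ℚ; 1ℚ; _*_)
open import Data.Product using (_×_)
open import Relation.Binary.PropositionalEquality using (_≡_)

open import Data.Nat as ℕ using (zero; suc; _<_; z≤n; s≤s; _!)
import Data.Nat.Properties as ℕ
import Data.Integer.Properties as ℤ
open import Data.Nat.Coprimality as Coprime using (1-coprimeTo)
open import Data.Integer as ℤ using (+_)
open import Data.Rational using (0ℚ; _+_; -_; _/_; mkℚ)
open import Data.Rational.Properties
  using ( normalize-coprime; /-cong; *-inverseʳ; +-assoc; +-identityˡ; +-identityʳ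
        ; *-assoc; *-comm; *-identityˡ; *-identityʳ; *-zeroˡ; *-zeroʳ; *-distribˡ-+; *-distribʳ-+)
open import Data.Rational.Solver using (module +-*-Solver)
open import Data.Sum using (inj₁; inj₂)
open import Data.Product using (_,_)
open import Relation.Binary.PropositionalEquality
  using (refl; sym; trans; cong; cong₂; _≗_; module ≡-Reasoning)
open ≡-Reasoning
open +-*-Solver

ι : ℕ → ℚ
ι n = + n / 1

ι≡mkℚ : ∀ n → ι n ≡ mkℚ (+ n) 0 (Coprime.sym (1-coprimeTo n))
ι≡mkℚ n = normalize-coprime (Coprime.sym (1-coprimeTo n))

ι-homo-+ : ∀ a b → ι (a ℕ.+ b) ≡ ι a + ι b
ι-homo-+ a b rewrite ι≡mkℚ a | ι≡mkℚ b =
  sym (/-cong (cong₂ ℤ._+_ (ℤ.*-identityʳ (+ a)) (ℤ.*-identityʳ (+ b))) refl)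

ι-homo-* : ∀ a b → ι (a ℕ.* b) ≡ ι a * ι b
ι-homo-* a b rewrite ι≡mkℚ a | ι≡mkℚ b =
  /-cong {p₁ = + (a ℕ.* b)} {q₁ = 1} {p₂ = + a ℤ.* + b} {q₂ = 1} (ℤ.pos-* a b) refl

ι-*-1/ : ∀ k .{{_ : ℕ.NonZero k}} → ι k * (+ 1 / k) ≡ 1ℚ
ι-*-1/ (suc k) rewrite ι≡mkℚ (suc k) | normalize-coprime {1} {k} (1-coprimeTo (suc k)) =
  *-inverseʳ (mkℚ (+ suc k) 0 (Coprime.sym (1-coprimeTo (suc k))))

fact-*-inv! : ∀ n → fact n * inv! n ≡ 1ℚ
fact-*-inv! n = ι-*-1/ (n !) {{n ℕ.!≢0}}

sgn-*-sgn : ∀ k → sgn k * sgn k ≡ 1ℚ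
sgn-*-sgn zero    = refl
sgn-*-sgn (suc k) =
  trans (solve 1 (λ s → ((:- con 1ℚ) :* s) :* ((:- con 1ℚ) :* s) := s :* s) refl (sgn k))
        (sgn-*-sgn k)

1^ℚn≡1 : ∀ n → 1ℚ ^ℚ n ≡ 1ℚ
1^ℚn≡1 zero    = refl
1^ℚn≡1 (suc n) = trans (*-identityˡ (1ℚ ^ℚ n)) (1^ℚn≡1 n)

ι-*-cancelˡ : ∀ k .{{_ : ℕ.NonZero k}} {y z} → ι k * y ≡ ι k * z → y ≡ z
ι-*-cancelˡ k {y} {z} eq = begin
  y                ≡⟨ sym (*-identityˡ y) ⟩
  1ℚ * y           ≡⟨ cong (_* y) (sym r*a≡1) ⟩
  (r * a) * y      ≡⟨ *-assoc r a y ⟩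
  r * (a * y)      ≡⟨ cong (r *_) eq ⟩
  r * (a * z)      ≡⟨ *-assoc r a z ⟨
  (r * a) * z      ≡⟨ cong (_* z) r*a≡1 ⟩
  1ℚ * z           ≡⟨ *-identityˡ z ⟩
  z                ∎
  where
  a = ι k
  r = + 1 / k
  r*a≡1 : r * a ≡ 1ℚ
  r*a≡1 = trans (*-comm r a) (ι-*-1/ k)

private
  +-interchange : ∀ a b c d → (a + b) + (c + d) ≡ (a + c) + (b + d)
  +-interchange = solve 4 (λ a b c d → (a :+ b) :+ (c :+ d) := (a :+ c) :+ (b :+ d)) refl

Σ0-cong : ∀ n {f g : ℕ → ℚ} → (∀ i → i ≤ n → f i ≡ g i) → Σ0 n f ≡ Σ0 n g
Σ0-cong zero    f≡g = f≡g 0 z≤n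
Σ0-cong (suc n) f≡g =
  cong₂ _+_ (Σ0-cong n (λ i i≤n → f≡g i (ℕ.m≤n⇒m≤1+n i≤n))) (f≡g (suc n) ℕ.≤-refl)

Σ1-cong : ∀ n {f g : ℕ → ℚ} → (∀ i → i ≤ n → f i ≡ g i) → Σ1 n f ≡ Σ1 n g
Σ1-cong zero    f≡g = refl
Σ1-cong (suc n) f≡g =
  cong₂ _+_ (Σ1-cong n (λ i i≤n → f≡g i (ℕ.m≤n⇒m≤1+n i≤n))) (f≡g (suc n) ℕ.≤-refl)

Σ0-zero : ∀ n {f : ℕ → ℚ} → (∀ i → i ≤ n → f i ≡ 0ℚ) → Σ0 n f ≡ 0ℚ
Σ0-zero zero    f≡0 = f≡0 0 z≤n
Σ0-zero (suc n) f≡0 =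
  cong₂ _+_ (Σ0-zero n (λ i i≤n → f≡0 i (ℕ.m≤n⇒m≤1+n i≤n))) (f≡0 (suc n) ℕ.≤-refl)

Σ1-zero : ∀ n {f : ℕ → ℚ} → (∀ i → i ≤ n → f i ≡ 0ℚ) → Σ1 n f ≡ 0ℚ
Σ1-zero zero    f≡0 = refl
Σ1-zero (suc n) f≡0 =
  cong₂ _+_ (Σ1-zero n (λ i i≤n → f≡0 i (ℕ.m≤n⇒m≤1+n i≤n))) (f≡0 (suc n) ℕ.≤-refl)

Σ0-distrib-+ : ∀ n (f g : ℕ → ℚ) → Σ0 n (λ i → f i + g i) ≡ Σ0 n f + Σ0 n g
Σ0-distrib-+ zero    f g = refl
Σ0-distrib-+ (suc n) f g rewrite Σ0-distrib-+ n f g =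
  +-interchange (Σ0 n f) (Σ0 n g) (f (suc n)) (g (suc n))

Σ1-distrib-+ : ∀ n (f g : ℕ → ℚ) → Σ1 n (λ i → f i + g i) ≡ Σ1 n f + Σ1 n g
Σ1-distrib-+ zero    f g = refl
Σ1-distrib-+ (suc n) f g rewrite Σ1-distrib-+ n f g =
  +-interchange (Σ1 n f) (Σ1 n g) (f (suc n)) (g (suc n))

*-distribˡ-Σ0 : ∀ n c (f : ℕ → ℚ) → c * Σ0 n f ≡ Σ0 n (λ i → c * f i)
*-distribˡ-Σ0 zero    c f = refl
*-distribˡ-Σ0 (suc n) c f rewrite sym (*-distribˡ-Σ0 n c f) = *-distribˡ-+ c _ _

*-distribˡ-Σ1 : ∀ n c (f : ℕ → ℚ) → c * Σ1 n f ≡ Σ1 n (λ i → c * f i)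
*-distribˡ-Σ1 zero    c f = *-zeroʳ c
*-distribˡ-Σ1 (suc n) c f rewrite sym (*-distribˡ-Σ1 n c f) = *-distribˡ-+ c _ _

*-distribʳ-Σ1 : ∀ n c (f : ℕ → ℚ) → Σ1 n f * c ≡ Σ1 n (λ i → f i * c)
*-distribʳ-Σ1 n c f = begin
  Σ1 n f * c              ≡⟨ *-comm (Σ1 n f) c ⟩
  c * Σ1 n f              ≡⟨ *-distribˡ-Σ1 n c f ⟩
  Σ1 n (λ i → c * f i)    ≡⟨ Σ1-cong n (λ i _ → *-comm c (f i)) ⟩
  Σ1 n (λ i → f i * c)    ∎

Σ0-suc-head : ∀ n (f : ℕ → ℚ) → Σ0 (suc n) f ≡ f 0 + Σ0 n (λ i → f (suc i))
Σ0-suc-head zero    f = refl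
Σ0-suc-head (suc n) f rewrite Σ0-suc-head n f = +-assoc (f 0) _ (f (suc (suc n)))

Σ0≡head+Σ1 : ∀ n (f : ℕ → ℚ) → Σ0 n f ≡ f 0 + Σ1 n f
Σ0≡head+Σ1 zero    f = sym (+-identityʳ (f 0))
Σ0≡head+Σ1 (suc n) f rewrite Σ0≡head+Σ1 n f = +-assoc (f 0) (Σ1 n f) (f (suc n))

Σ1-comm : ∀ n m (F : ℕ → ℕ → ℚ) →
          Σ1 n (λ i → Σ1 m (λ j → F i j)) ≡ Σ1 m (λ j → Σ1 n (λ i → F i j))
Σ1-comm zero    m F = sym (Σ1-zero m (λ _ _ → refl))
Σ1-comm (suc n) m F rewrite Σ1-comm n m F = sym (Σ1-distrib-+ m _ _)

Σ1-truncate : ∀ k n (f : ℕ → ℚ) → k ≤ n → (∀ m → k < m → m ≤ n → f m ≡ 0ℚ) →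
              Σ1 n f ≡ Σ1 k f
Σ1-truncate _ zero f z≤n _ = refl
Σ1-truncate k (suc n) f k≤1+n tail≡0 with ℕ.m≤n⇒m<n∨m≡n k≤1+n
... | inj₂ refl = refl
... | inj₁ k<1+n = begin
  Σ1 n f + f (suc n)  ≡⟨ cong₂ _+_ (Σ1-truncate k n f (ℕ.≤-pred k<1+n) tail≡0′)
                                   (tail≡0 (suc n) k<1+n ℕ.≤-refl) ⟩
  Σ1 k f + 0ℚ         ≡⟨ +-identityʳ _ ⟩
  Σ1 k f              ∎
  where
  tail≡0′ : ∀ m → k < m → m ≤ n → f m ≡ 0ℚ
  tail≡0′ m k<m m≤n = tail≡0 m k<m (ℕ.m≤n⇒m≤1+n m≤n)

infixl 6 _⊕_
_⊕_ : Series → Series → Series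
(f ⊕ g) n = f n + g n

∂ : Series → Series
∂ f n = ι (suc n) * f (suc n)

infixr 25 [1+t]*_
[1+t]*_ : Series → Series
([1+t]* f) zero    = f 0
([1+t]* f) (suc n) = f (suc n) + f n

⊛-congˡ : ∀ {f f′} g → f ≗ f′ → f ⊛ g ≗ f′ ⊛ g
⊛-congˡ g f≗f′ n = Σ0-cong n (λ i _ → cong (_* g (n ∸ i)) (f≗f′ i))

⊛-congʳ : ∀ f {g g′} → g ≗ g′ → f ⊛ g ≗ f ⊛ g′
⊛-congʳ f g≗g′ n = Σ0-cong n (λ i _ → cong (f i *_) (g≗g′ (n ∸ i)))

⊛-distribˡ-⊕ : ∀ f g h → f ⊛ (g ⊕ h) ≗ f ⊛ g ⊕ f ⊛ h
⊛-distribˡ-⊕ f g h n =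
  trans (Σ0-cong n (λ i _ → *-distribˡ-+ (f i) (g (n ∸ i)) (h (n ∸ i)))) (Σ0-distrib-+ n _ _)

⊛-distribʳ-⊕ : ∀ f g h → (f ⊕ g) ⊛ h ≗ f ⊛ h ⊕ g ⊛ h
⊛-distribʳ-⊕ f g h n =
  trans (Σ0-cong n (λ i _ → *-distribʳ-+ (h (n ∸ i)) (f i) (g i))) (Σ0-distrib-+ n _ _)

⊛-scaleˡ : ∀ c f g → scale c f ⊛ g ≗ scale c (f ⊛ g)
⊛-scaleˡ c f g n =
  trans (Σ0-cong n (λ i _ → *-assoc c (f i) (g (n ∸ i)))) (sym (*-distribˡ-Σ0 n c _))

⊛-scaleʳ : ∀ f c g → f ⊛ scale c g ≗ scale c (f ⊛ g)
⊛-scaleʳ f c g n = trans (Σ0-cong n (λ i _ → swap (f i) (g (n ∸ i)))) (sym (*-distribˡ-Σ0 n c _))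
  where
  swap : ∀ a b → a * (c * b) ≡ c * (a * b)
  swap = solve 3 (λ c a b → a :* (c :* b) := c :* (a :* b)) refl c

⊛-identityˡ : ∀ f → one ⊛ f ≗ f
⊛-identityˡ f zero    = *-identityˡ (f 0)
⊛-identityˡ f (suc n) = begin
  (one ⊛ f) (suc n)                              ≡⟨ Σ0-suc-head n _ ⟩
  1ℚ * f (suc n) + Σ0 n (λ i → 0ℚ * f (n ∸ i))   ≡⟨ cong₂ _+_ (*-identityˡ (f (suc n)))
                                                             (Σ0-zero n (λ i _ → *-zeroˡ (f (n ∸ i)))) ⟩
  f (suc n) + 0ℚ                                 ≡⟨ +-identityʳ (f (suc n)) ⟩
  f (suc n)                                      ∎

pow-scale : ∀ x f m → pow (scale x f) m ≗ scale (x ^ℚ m) (pow f m)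
pow-scale x f zero    k = sym (*-identityˡ (one k))
pow-scale x f (suc m) k = begin
  (scale x f ⊛ pow (scale x f) m) k        ≡⟨ ⊛-congʳ (scale x f) (pow-scale x f m) k ⟩
  (scale x f ⊛ scale (x ^ℚ m) (pow f m)) k ≡⟨ ⊛-scaleʳ (scale x f) (x ^ℚ m) (pow f m) k ⟩
  x ^ℚ m * (scale x f ⊛ pow f m) k         ≡⟨ cong (x ^ℚ m *_) (⊛-scaleˡ x f (pow f m) k) ⟩
  x ^ℚ m * (x * pow f (suc m) k)           ≡⟨ reorder (x ^ℚ m) x (pow f (suc m) k) ⟩
  x ^ℚ suc m * pow f (suc m) k             ∎
  where
  reorder : ∀ a x p → a * (x * p) ≡ (x * a) * p
  reorder = solve 3 (λ a x p → a :* (x :* p) := (x :* a) :* p) refl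

pow-vanishes-below : ∀ f → f 0 ≡ 0ℚ → ∀ k n → n < k → pow f k n ≡ 0ℚ
pow-vanishes-below f f0≡0 (suc k) n n<1+k = Σ0-zero n term≡0
  where
  term≡0 : ∀ i → i ≤ n → f i * pow f k (n ∸ i) ≡ 0ℚ
  term≡0 zero    _   = trans (cong (_* pow f k n) f0≡0) (*-zeroˡ (pow f k n))
  term≡0 (suc i) i<n =
    trans (cong (f (suc i) *_) (pow-vanishes-below f f0≡0 k (n ∸ suc i) (index<k i<n n<1+k)))
          (*-zeroʳ (f (suc i)))
    where
    index<k : ∀ {n} → suc i ≤ n → n < suc k → n ∸ suc i < k
    index<k {suc n} _ n<1+k = ℕ.≤-<-trans (ℕ.m∸n≤m n i) (ℕ.≤-pred n<1+k)

∂-one : ∀ n → ∂ one n ≡ 0ℚ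
∂-one n = *-zeroʳ (ι (suc n))

∂-⊛ : ∀ f g → ∂ (f ⊛ g) ≗ ∂ f ⊛ g ⊕ f ⊛ ∂ g
∂-⊛ f g n = begin
  ι (suc n) * Σ0 (suc n) (λ i → f i * g (suc n ∸ i))
    ≡⟨ *-distribˡ-Σ0 (suc n) (ι (suc n)) _ ⟩
  Σ0 (suc n) (λ i → ι (suc n) * (f i * g (suc n ∸ i)))
    ≡⟨ Σ0-cong (suc n) split ⟩
  Σ0 (suc n) (λ i → ι i * f i * g (suc n ∸ i) + f i * (ι (suc n ∸ i) * g (suc n ∸ i)))
    ≡⟨ Σ0-distrib-+ (suc n) _ _ ⟩
  Σ0 (suc n) (λ i → ι i * f i * g (suc n ∸ i)) + Σ0 (suc n) (λ i → f i * (ι (suc n ∸ i) * g (suc n ∸ i)))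
    ≡⟨ cong₂ _+_ ∂f-part ∂g-part ⟩
  (∂ f ⊛ g) n + (f ⊛ ∂ g) n
    ∎
  where
  split : ∀ i → i ≤ suc n → ι (suc n) * (f i * g (suc n ∸ i)) ≡
          ι i * f i * g (suc n ∸ i) + f i * (ι (suc n ∸ i) * g (suc n ∸ i))
  split i i≤1+n = begin
    ι (suc n) * (f i * g j)             ≡⟨ cong (λ m → ι m * (f i * g j)) (sym (ℕ.m+[n∸m]≡n i≤1+n)) ⟩
    ι (i ℕ.+ j) * (f i * g j)           ≡⟨ cong (_* (f i * g j)) (ι-homo-+ i j) ⟩
    (ι i + ι j) * (f i * g j)           ≡⟨ distrib (ι i) (ι j) (f i) (g j) ⟩
    ι i * f i * g j + f i * (ι j * g j) ∎
    where
    j = suc n ∸ i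
    distrib : ∀ a b x y → (a + b) * (x * y) ≡ a * x * y + x * (b * y)
    distrib = solve 4 (λ a b x y → (a :+ b) :* (x :* y) := a :* x :* y :+ x :* (b :* y)) refl

  ∂f-part : Σ0 (suc n) (λ i → ι i * f i * g (suc n ∸ i)) ≡ (∂ f ⊛ g) n
  ∂f-part = begin
    Σ0 (suc n) (λ i → ι i * f i * g (suc n ∸ i))       ≡⟨ Σ0-suc-head n _ ⟩
    0ℚ * f 0 * g (suc n) + (∂ f ⊛ g) n                 ≡⟨ cong (_+ (∂ f ⊛ g) n) head≡0 ⟩
    0ℚ + (∂ f ⊛ g) n                                   ≡⟨ +-identityˡ _ ⟩
    (∂ f ⊛ g) n                                        ∎
    where
    head≡0 : 0ℚ * f 0 * g (suc n) ≡ 0ℚ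
    head≡0 = trans (cong (_* g (suc n)) (*-zeroˡ (f 0))) (*-zeroˡ (g (suc n)))

  ∂g-part : Σ0 (suc n) (λ i → f i * (ι (suc n ∸ i) * g (suc n ∸ i))) ≡ (f ⊛ ∂ g) n
  ∂g-part = begin
    Σ0 n (λ i → f i * (ι (suc n ∸ i) * g (suc n ∸ i))) + f (suc n) * (ι (n ∸ n) * g (n ∸ n))
      ≡⟨ cong₂ _+_ (Σ0-cong n (λ i i≤n → cong (λ m → f i * (ι m * g m)) (ℕ.+-∸-assoc 1 i≤n)))
                   (cong (λ m → f (suc n) * (ι m * g m)) (ℕ.n∸n≡0 n)) ⟩
    (f ⊛ ∂ g) n + f (suc n) * (0ℚ * g 0)
      ≡⟨ cong (λ z → (f ⊛ ∂ g) n + z) (trans (cong (f (suc n) *_) (*-zeroˡ (g 0))) (*-zeroʳ (f (suc n)))) ⟩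
    (f ⊛ ∂ g) n + 0ℚ
      ≡⟨ +-identityʳ _ ⟩
    (f ⊛ ∂ g) n
      ∎

[1+t]*-cong : ∀ {f g} → f ≗ g → [1+t]* f ≗ [1+t]* g
[1+t]*-cong f≗g zero    = f≗g 0
[1+t]*-cong f≗g (suc n) = cong₂ _+_ (f≗g (suc n)) (f≗g n)

[1+t]*-distrib-⊕ : ∀ f g → [1+t]* (f ⊕ g) ≗ [1+t]* f ⊕ [1+t]* g
[1+t]*-distrib-⊕ f g zero    = refl
[1+t]*-distrib-⊕ f g (suc n) = +-interchange (f (suc n)) (g (suc n)) (f n) (g n)

[1+t]*-⊛ˡ : ∀ f g → [1+t]* (f ⊛ g) ≗ ([1+t]* f) ⊛ g
[1+t]*-⊛ˡ f g zero    = refl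
[1+t]*-⊛ˡ f g (suc n) = begin
  Σ0 (suc n) (λ i → f i * g (suc n ∸ i)) + Σ0 n (λ i → f i * g (n ∸ i))
    ≡⟨ cong (_+ Σ0 n (λ i → f i * g (n ∸ i))) (Σ0-suc-head n _) ⟩
  (f 0 * g (suc n) + Σ0 n (λ i → f (suc i) * g (n ∸ i))) + Σ0 n (λ i → f i * g (n ∸ i))
    ≡⟨ +-assoc (f 0 * g (suc n)) _ _ ⟩
  f 0 * g (suc n) + (Σ0 n (λ i → f (suc i) * g (n ∸ i)) + Σ0 n (λ i → f i * g (n ∸ i)))
    ≡⟨ cong (λ z → f 0 * g (suc n) + z) (sym (Σ0-distrib-+ n _ _)) ⟩
  f 0 * g (suc n) + Σ0 n (λ i → f (suc i) * g (n ∸ i) + f i * g (n ∸ i))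
    ≡⟨ cong (λ z → f 0 * g (suc n) + z) (Σ0-cong n (λ i _ → sym (*-distribʳ-+ (g (n ∸ i)) (f (suc i)) (f i)))) ⟩
  ([1+t]* f) 0 * g (suc n) + Σ0 n (λ i → ([1+t]* f) (suc i) * g (n ∸ i))
    ≡⟨ Σ0-suc-head n _ ⟨
  (([1+t]* f) ⊛ g) (suc n)
    ∎

[1+t]*-⊛ʳ : ∀ f g → [1+t]* (f ⊛ g) ≗ f ⊛ [1+t]* g
[1+t]*-⊛ʳ f g zero    = refl
[1+t]*-⊛ʳ f g (suc n) = begin
  (Σ0 n (λ i → f i * g (suc n ∸ i)) + f (suc n) * g (n ∸ n)) + Σ0 n (λ i → f i * g (n ∸ i))
    ≡⟨ swap-last (Σ0 n (λ i → f i * g (suc n ∸ i))) _ _ ⟩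
  (Σ0 n (λ i → f i * g (suc n ∸ i)) + Σ0 n (λ i → f i * g (n ∸ i))) + f (suc n) * g (n ∸ n)
    ≡⟨ cong₂ _+_ (sym (Σ0-distrib-+ n _ _)) (cong (λ m → f (suc n) * g m) (ℕ.n∸n≡0 n)) ⟩
  Σ0 n (λ i → f i * g (suc n ∸ i) + f i * g (n ∸ i)) + f (suc n) * g 0
    ≡⟨ cong₂ _+_ (Σ0-cong n factor) (cong (λ m → f (suc n) * ([1+t]* g) m) (sym (ℕ.n∸n≡0 n))) ⟩
  (f ⊛ [1+t]* g) (suc n)
    ∎
  where
  swap-last : ∀ a b c → (a + b) + c ≡ (a + c) + b
  swap-last = solve 3 (λ a b c → (a :+ b) :+ c := (a :+ c) :+ b) refl
  factor : ∀ i → i ≤ n → f i * g (suc n ∸ i) + f i * g (n ∸ i) ≡ f i * ([1+t]* g) (suc n ∸ i)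
  factor i i≤n rewrite ℕ.+-∸-assoc 1 i≤n = sym (*-distribˡ-+ (f i) _ _)

ι-*-⊛-pow-pred : ∀ f m n → ι m * (f ⊛ pow f (m ∸ 1)) n ≡ ι m * pow f m n
ι-*-⊛-pow-pred f zero    n = trans (*-zeroˡ ((f ⊛ one) n)) (sym (*-zeroˡ (one n)))
ι-*-⊛-pow-pred f (suc m) n = refl

+-ι-*-absorb : ∀ m s → s + ι m * s ≡ ι (suc m) * s
+-ι-*-absorb m s = begin
  s + ι m * s       ≡⟨ solve 2 (λ a s → s :+ a :* s := (con 1ℚ :+ a) :* s) refl (ι m) s ⟩
  (1ℚ + ι m) * s    ≡⟨ cong (_* s) (ι-homo-+ 1 m) ⟨
  ι (suc m) * s     ∎

[1+t]*-∂-pow : ∀ {f} → [1+t]* ∂ f ≗ one → ∀ m → [1+t]* ∂ (pow f m) ≗ scale (ι m) (pow f (m ∸ 1))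
[1+t]*-∂-pow {f} f′ zero zero    = trans (∂-one 0) (sym (*-zeroˡ (one 0)))
[1+t]*-∂-pow {f} f′ zero (suc k) =
  trans (cong₂ _+_ (∂-one (suc k)) (∂-one k)) (sym (*-zeroˡ (one (suc k))))
[1+t]*-∂-pow {f} f′ (suc m) k = begin
  ([1+t]* ∂ (f ⊛ F)) k
    ≡⟨ [1+t]*-cong (∂-⊛ f F) k ⟩
  ([1+t]* (∂ f ⊛ F ⊕ f ⊛ ∂ F)) k
    ≡⟨ [1+t]*-distrib-⊕ (∂ f ⊛ F) (f ⊛ ∂ F) k ⟩
  ([1+t]* (∂ f ⊛ F)) k + ([1+t]* (f ⊛ ∂ F)) k
    ≡⟨ cong₂ _+_ ([1+t]*-⊛ˡ (∂ f) F k) ([1+t]*-⊛ʳ f (∂ F) k) ⟩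
  (([1+t]* ∂ f) ⊛ F) k + (f ⊛ [1+t]* ∂ F) k
    ≡⟨ cong₂ _+_ (⊛-congˡ F f′ k) (⊛-congʳ f ([1+t]*-∂-pow f′ m) k) ⟩
  (one ⊛ F) k + (f ⊛ scale (ι m) F′) k
    ≡⟨ cong₂ _+_ (⊛-identityˡ F k) (⊛-scaleʳ f (ι m) F′ k) ⟩
  F k + ι m * (f ⊛ F′) k
    ≡⟨ cong (λ z → F k + z) (ι-*-⊛-pow-pred f m k) ⟩
  F k + ι m * F k
    ≡⟨ +-ι-*-absorb m (F k) ⟩
  ι (suc m) * F k
    ∎
  where
  F  = pow f m
  F′ = pow f (m ∸ 1)

∂-pow : ∀ {g} → ∂ g ≗ g ⊕ one → ∀ k → ∂ (pow g k) ≗ scale (ι k) (pow g k ⊕ pow g (k ∸ 1))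
∂-pow {g} g′ zero    n = trans (∂-one n) (sym (*-zeroˡ (one n + one n)))
∂-pow {g} g′ (suc k) n = begin
  ∂ (g ⊛ G) n
    ≡⟨ ∂-⊛ g G n ⟩
  (∂ g ⊛ G) n + (g ⊛ ∂ G) n
    ≡⟨ cong₂ _+_ (⊛-congˡ G g′ n) (⊛-congʳ g (∂-pow g′ k) n) ⟩
  ((g ⊕ one) ⊛ G) n + (g ⊛ scale (ι k) (G ⊕ G′)) n
    ≡⟨ cong₂ _+_ (⊛-distribʳ-⊕ g one G n) (⊛-scaleʳ g (ι k) (G ⊕ G′) n) ⟩
  ((g ⊛ G) n + (one ⊛ G) n) + ι k * (g ⊛ (G ⊕ G′)) n
    ≡⟨ cong₂ (λ a b → ((g ⊛ G) n + a) + ι k * b) (⊛-identityˡ G n) (⊛-distribˡ-⊕ g G G′ n) ⟩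
  ((g ⊛ G) n + G n) + ι k * ((g ⊛ G) n + (g ⊛ G′) n)
    ≡⟨ cong (λ z → ((g ⊛ G) n + G n) + z) lower-power ⟩
  ((g ⊛ G) n + G n) + ι k * ((g ⊛ G) n + G n)
    ≡⟨ +-ι-*-absorb k _ ⟩
  ι (suc k) * ((g ⊛ G) n + G n)
    ∎
  where
  G  = pow g k
  G′ = pow g (k ∸ 1)
  lower-power : ι k * ((g ⊛ G) n + (g ⊛ G′) n) ≡ ι k * ((g ⊛ G) n + G n)
  lower-power = begin
    ι k * ((g ⊛ G) n + (g ⊛ G′) n)        ≡⟨ *-distribˡ-+ (ι k) _ _ ⟩
    ι k * (g ⊛ G) n + ι k * (g ⊛ G′) n    ≡⟨ cong (λ z → ι k * (g ⊛ G) n + z) (ι-*-⊛-pow-pred g k n) ⟩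
    ι k * (g ⊛ G) n + ι k * G n           ≡⟨ *-distribˡ-+ (ι k) _ _ ⟨
    ι k * ((g ⊛ G) n + G n)               ∎

module Inversion (f g : Series) (f′ : [1+t]* ∂ f ≗ one) (g′ : ∂ g ≗ g ⊕ one) (g0≡0 : g 0 ≡ 0ℚ) where

  -- The coefficient of t^n in f^m ∘ g; the sum may stop at k = n since g^k has order k.
  composite : ℕ → ℕ → ℚ
  composite m n = Σ0 n (λ k → pow f m k * pow g k n)

  pow-f-coeff : ∀ m k → ι (suc k) * pow f m (suc k) + ι k * pow f m k ≡ ι m * pow f (m ∸ 1) k
  pow-f-coeff m zero    = trans (cong (λ z → ι 1 * pow f m 1 + z) (*-zeroˡ (pow f m 0)))
                                (trans (+-identityʳ _) ([1+t]*-∂-pow f′ m 0))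
  pow-f-coeff m (suc k) = [1+t]*-∂-pow f′ m (suc k)

  -- F_m′ = m F_{m−1}, read off at t^n.
  composite-rec : ∀ m n → ι (suc n) * composite m (suc n) ≡ ι m * composite (m ∸ 1) n
  composite-rec m n = begin
    ι (suc n) * Σ0 (suc n) (λ k → pow f m k * pow g k (suc n))  ≡⟨ *-distribˡ-Σ0 (suc n) (ι (suc n)) _ ⟩
    Σ0 (suc n) (λ k → ι (suc n) * (pow f m k * pow g k (suc n))) ≡⟨ Σ0-cong (suc n) (λ k _ → split k) ⟩
    Σ0 (suc n) (λ k → U k + V k)                                 ≡⟨ Σ0-distrib-+ (suc n) U V ⟩
    Σ0 (suc n) U + Σ0 (suc n) V                                  ≡⟨ cong₂ _+_ drop-last drop-first ⟩
    Σ0 n U + Σ0 n (λ k → V (suc k))                              ≡⟨ Σ0-distrib-+ n U (λ k → V (suc k)) ⟨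
    Σ0 n (λ k → U k + V (suc k))                                 ≡⟨ Σ0-cong n (λ k _ → merge k) ⟩
    Σ0 n (λ k → ι m * (pow f (m ∸ 1) k * pow g k n))             ≡⟨ *-distribˡ-Σ0 n (ι m) _ ⟨
    ι m * composite (m ∸ 1) n                                    ∎
    where
    U V : ℕ → ℚ
    U k = ι k * pow f m k * pow g k n
    V k = ι k * pow f m k * pow g (k ∸ 1) n

    split : ∀ k → ι (suc n) * (pow f m k * pow g k (suc n)) ≡ U k + V k
    split k = begin
      ι (suc n) * (pow f m k * pow g k (suc n))
        ≡⟨ solve 3 (λ a p q → a :* (p :* q) := p :* (a :* q)) refl (ι (suc n)) (pow f m k) _ ⟩
      pow f m k * ∂ (pow g k) n
        ≡⟨ cong (pow f m k *_) (∂-pow g′ k n) ⟩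
      pow f m k * (ι k * (pow g k n + pow g (k ∸ 1) n))
        ≡⟨ solve 4 (λ p a x z → p :* (a :* (x :+ z)) := a :* p :* x :+ a :* p :* z) refl (pow f m k) (ι k) _ _ ⟩
      U k + V k
        ∎

    drop-last : Σ0 (suc n) U ≡ Σ0 n U
    drop-last = trans (cong (λ z → Σ0 n U + z) U-last≡0) (+-identityʳ (Σ0 n U))
      where
      U-last≡0 : U (suc n) ≡ 0ℚ
      U-last≡0 = trans (cong (ι (suc n) * pow f m (suc n) *_)
                             (pow-vanishes-below g g0≡0 (suc n) n (ℕ.n<1+n n)))
                       (*-zeroʳ (ι (suc n) * pow f m (suc n)))

    drop-first : Σ0 (suc n) V ≡ Σ0 n (λ k → V (suc k))
    drop-first = trans (Σ0-suc-head n V) (trans (cong (_+ Σ0 n (λ k → V (suc k))) V0≡0) (+-identityˡ _))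
      where
      V0≡0 : V 0 ≡ 0ℚ
      V0≡0 = trans (cong (_* pow g 0 n) (*-zeroˡ (pow f m 0))) (*-zeroˡ (pow g 0 n))

    merge : ∀ k → U k + V (suc k) ≡ ι m * (pow f (m ∸ 1) k * pow g k n)
    merge k = begin
      ι k * pow f m k * pow g k n + ι (suc k) * pow f m (suc k) * pow g k n
        ≡⟨ solve 5 (λ a p b r q → a :* p :* q :+ b :* r :* q := (b :* r :+ a :* p) :* q)
                   refl (ι k) (pow f m k) (ι (suc k)) (pow f m (suc k)) (pow g k n) ⟩
      (ι (suc k) * pow f m (suc k) + ι k * pow f m k) * pow g k n
        ≡⟨ cong (_* pow g k n) (pow-f-coeff m k) ⟩
      ι m * pow f (m ∸ 1) k * pow g k n
        ≡⟨ *-assoc (ι m) _ _ ⟩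
      ι m * (pow f (m ∸ 1) k * pow g k n)
        ∎

  composite-diag : ∀ n → composite n n ≡ 1ℚ
  composite-diag zero    = refl
  composite-diag (suc n) =
    ι-*-cancelˡ (suc n) (trans (composite-rec (suc n) n) (cong (ι (suc n) *_) (composite-diag n)))

  composite-below : ∀ {m n} → m < n → composite m n ≡ 0ℚ
  composite-below {zero}  {suc n} _ =
    ι-*-cancelˡ (suc n) (trans (composite-rec 0 n) (trans (*-zeroˡ (composite 0 n)) (sym (*-zeroʳ (ι (suc n))))))
  composite-below {suc m} {suc n} (s≤s m<n) =
    ι-*-cancelˡ (suc n) (begin
      ι (suc n) * composite (suc m) (suc n)  ≡⟨ composite-rec (suc m) n ⟩
      ι (suc m) * composite m n              ≡⟨ cong (ι (suc m) *_) (composite-below m<n) ⟩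
      ι (suc m) * 0ℚ                         ≡⟨ *-zeroʳ (ι (suc m)) ⟩
      0ℚ                                     ≡⟨ *-zeroʳ (ι (suc n)) ⟨
      ι (suc n) * 0ℚ                         ∎)

∂-log1+t : ∀ k → ∂ log1+t k ≡ sgn k
∂-log1+t k = begin
  ι (suc k) * (sgn k * recip (suc k)) ≡⟨ solve 3 (λ a s r → a :* (s :* r) := s :* (a :* r)) refl (ι (suc k)) (sgn k) _ ⟩
  sgn k * (ι (suc k) * recip (suc k)) ≡⟨ cong (sgn k *_) (ι-*-1/ (suc k)) ⟩
  sgn k * 1ℚ                          ≡⟨ *-identityʳ (sgn k) ⟩
  sgn k                               ∎

[1+t]*-∂-log1+t : [1+t]* ∂ log1+t ≗ one
[1+t]*-∂-log1+t zero    = ∂-log1+t 0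
[1+t]*-∂-log1+t (suc k) = begin
  ∂ log1+t (suc k) + ∂ log1+t k ≡⟨ cong₂ _+_ (∂-log1+t (suc k)) (∂-log1+t k) ⟩
  - 1ℚ * sgn k + sgn k          ≡⟨ solve 1 (λ s → (:- con 1ℚ) :* s :+ s := con 0ℚ) refl (sgn k) ⟩
  0ℚ                            ∎

ι-suc-*-inv!-suc : ∀ j → ι (suc j) * inv! (suc j) ≡ inv! j
ι-suc-*-inv!-suc j = ι-*-cancelˡ (j !) {{j ℕ.!≢0}} (begin
  fact j * (ι (suc j) * inv! (suc j))  ≡⟨ solve 3 (λ a b c → a :* (b :* c) := (b :* a) :* c)
                                                 refl (fact j) (ι (suc j)) (inv! (suc j)) ⟩
  (ι (suc j) * fact j) * inv! (suc j)  ≡⟨ cong (_* inv! (suc j)) (ι-homo-* (suc j) (j !)) ⟨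
  fact (suc j) * inv! (suc j)          ≡⟨ fact-*-inv! (suc j) ⟩
  1ℚ                                   ≡⟨ fact-*-inv! j ⟨
  fact j * inv! j                      ∎)

∂-expm1 : ∂ expm1 ≗ expm1 ⊕ one
∂-expm1 zero    = ι-suc-*-inv!-suc 0
∂-expm1 (suc j) = trans (ι-suc-*-inv!-suc (suc j)) (sym (+-identityʳ _))

open Inversion log1+t expm1 [1+t]*-∂-log1+t ∂-expm1 refl

-- The coefficient of u^m in log(1 + x u).
logCoeff : ℚ → ℕ → ℚ
logCoeff x m = sgn (m ∸ 1) * recip m * x ^ℚ m

bel-expansion : ∀ x {k n} → k ≤ n → bel k x ≡ fact k * Σ1 n (λ m → logCoeff x m * pow log1+t m k)
bel-expansion x {k} {n} k≤n = cong (fact k *_) (begin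
  Σ1 k (λ m → sgn (m ∸ 1) * recip m * pow (scale x log1+t) m k)  ≡⟨ Σ1-cong k (λ m _ → pull-power m) ⟩
  Σ1 k (λ m → logCoeff x m * pow log1+t m k)                     ≡⟨ Σ1-truncate k n _ k≤n high≡0 ⟨
  Σ1 n (λ m → logCoeff x m * pow log1+t m k)                     ∎)
  where
  pull-power : ∀ m → sgn (m ∸ 1) * recip m * pow (scale x log1+t) m k ≡ logCoeff x m * pow log1+t m k
  pull-power m = trans (cong (sgn (m ∸ 1) * recip m *_) (pow-scale x log1+t m k))
                       (sym (*-assoc (sgn (m ∸ 1) * recip m) (x ^ℚ m) (pow log1+t m k)))
  high≡0 : ∀ m → k < m → m ≤ n → logCoeff x m * pow log1+t m k ≡ 0ℚ
  high≡0 m k<m _ = trans (cong (logCoeff x m *_) (pow-vanishes-below log1+t refl m k k<m))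
                         (*-zeroʳ (logCoeff x m))

bel-*-S₂ : ∀ x {k n} → k ≤ n →
           bel k x * S₂ n k ≡ fact n * Σ1 n (λ m → logCoeff x m * (pow log1+t m k * pow expm1 k n))
bel-*-S₂ x {k} {n} k≤n = begin
  bel k x * (fact n * (inv! k * Q))
    ≡⟨ cong (_* (fact n * (inv! k * Q))) (bel-expansion x k≤n) ⟩
  (fact k * Σ) * (fact n * (inv! k * Q))
    ≡⟨ solve 5 (λ a s f i q → (a :* s) :* (f :* (i :* q)) := (a :* i) :* (f :* (s :* q)))
               refl (fact k) Σ (fact n) (inv! k) Q ⟩
  (fact k * inv! k) * (fact n * (Σ * Q))
    ≡⟨ cong (_* (fact n * (Σ * Q))) (fact-*-inv! k) ⟩
  1ℚ * (fact n * (Σ * Q))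
    ≡⟨ *-identityˡ _ ⟩
  fact n * (Σ * Q)
    ≡⟨ cong (fact n *_) (*-distribʳ-Σ1 n Q _) ⟩
  fact n * Σ1 n (λ m → logCoeff x m * P m * Q)
    ≡⟨ cong (fact n *_) (Σ1-cong n (λ m _ → *-assoc (logCoeff x m) (P m) Q)) ⟩
  fact n * Σ1 n (λ m → logCoeff x m * (P m * Q))
    ∎
  where
  P : ℕ → ℚ
  P m = pow log1+t m k
  Q = pow expm1 k n
  Σ = Σ1 n (λ m → logCoeff x m * P m)

Σ-bel-*-S₂ : ∀ x n → Σ1 (suc n) (λ k → bel k x * S₂ (suc n) k) ≡ fact (suc n) * logCoeff x (suc n)
Σ-bel-*-S₂ x n = begin
  Σ1 N (λ k → bel k x * S₂ N k)                          ≡⟨ Σ1-cong N (λ k k≤N → bel-*-S₂ x k≤N) ⟩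
  Σ1 N (λ k → fact N * Σ1 N (λ m → c m * term m k))      ≡⟨ *-distribˡ-Σ1 N (fact N) _ ⟨
  fact N * Σ1 N (λ k → Σ1 N (λ m → c m * term m k))      ≡⟨ cong (fact N *_) (Σ1-comm N N _) ⟩
  fact N * Σ1 N (λ m → Σ1 N (λ k → c m * term m k))      ≡⟨ cong (fact N *_) (Σ1-cong N (λ m _ → pull-coeff m)) ⟩
  fact N * Σ1 N (λ m → c m * composite m N)              ≡⟨ cong (fact N *_) Σ1-*-composite ⟩
  fact N * c N                                           ∎
  where
  N = suc n
  c = logCoeff x
  term : ℕ → ℕ → ℚ
  term m k = pow log1+t m k * pow expm1 k N

  Σ1≡composite : ∀ m → Σ1 N (term m) ≡ composite m N
  Σ1≡composite m = sym (begin
    composite m N                        ≡⟨ Σ0≡head+Σ1 N (term m) ⟩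
    pow log1+t m 0 * 0ℚ + Σ1 N (term m)  ≡⟨ cong (_+ Σ1 N (term m)) (*-zeroʳ (pow log1+t m 0)) ⟩
    0ℚ + Σ1 N (term m)                   ≡⟨ +-identityˡ (Σ1 N (term m)) ⟩
    Σ1 N (term m)                        ∎)

  pull-coeff : ∀ m → Σ1 N (λ k → c m * term m k) ≡ c m * composite m N
  pull-coeff m = trans (sym (*-distribˡ-Σ1 N (c m) (term m))) (cong (c m *_) (Σ1≡composite m))

  Σ1-*-composite : Σ1 N (λ m → c m * composite m N) ≡ c N
  Σ1-*-composite = begin
    Σ1 n (λ m → c m * composite m N) + c N * composite N N
      ≡⟨ cong₂ _+_ (Σ1-zero n below≡0) (cong (c N *_) (composite-diag N)) ⟩
    0ℚ + c N * 1ℚ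
      ≡⟨ +-identityˡ _ ⟩
    c N * 1ℚ
      ≡⟨ *-identityʳ (c N) ⟩
    c N
      ∎
    where
    below≡0 : ∀ m → m ≤ n → c m * composite m N ≡ 0ℚ
    below≡0 m m≤n = trans (cong (c m *_) (composite-below (s≤s m≤n))) (*-zeroʳ (c m))

sgn-*-inv!-*-fact-*-logCoeff : ∀ n x →
                               (sgn n * inv! n) * (fact (suc n) * logCoeff x (suc n)) ≡ x ^ℚ suc n
sgn-*-inv!-*-fact-*-logCoeff n x = begin
  (s * inv! n) * (fact (suc n) * (s * r * X))
    ≡⟨ cong (λ z → (s * inv! n) * (z * (s * r * X))) (ι-homo-* (suc n) (n !)) ⟩
  (s * inv! n) * ((a * fact n) * (s * r * X))
    ≡⟨ solve 6 (λ s i a f r X → (s :* i) :* ((a :* f) :* (s :* r :* X))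
                              := ((s :* s) :* (f :* i)) :* (a :* r) :* X)
               refl s (inv! n) a (fact n) r X ⟩
  ((s * s) * (fact n * inv! n)) * (a * r) * X
    ≡⟨ cong₂ (λ u v → u * v * X) (cong₂ _*_ (sgn-*-sgn n) (fact-*-inv! n)) (ι-*-1/ (suc n)) ⟩
  (1ℚ * 1ℚ) * 1ℚ * X
    ≡⟨ *-identityˡ X ⟩
  X
    ∎
  where
  s = sgn n
  a = ι (suc n)
  r = recip (suc n)
  X = x ^ℚ suc n

theorem4 : (n : ℕ) → 1 ≤ n →
    ((x : ℚ) → x ^ℚ n ≡ (sgn (n ∸ 1) * inv! (n ∸ 1)) * Σ1 n (λ k → bel k x * S₂ n k))
    × (1ℚ ≡ (sgn (n ∸ 1) * inv! (n ∸ 1)) * Σ1 n (λ k → bel k 1ℚ * S₂ n k))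
theorem4 (suc n) _ = x^n≡Σ , trans (sym (1^ℚn≡1 (suc n))) (x^n≡Σ 1ℚ)
  where
  x^n≡Σ : ∀ x → x ^ℚ suc n ≡ (sgn n * inv! n) * Σ1 (suc n) (λ k → bel k x * S₂ (suc n) k)
  x^n≡Σ x = begin
    x ^ℚ suc n                                                  ≡⟨ sgn-*-inv!-*-fact-*-logCoeff n x ⟨
    (sgn n * inv! n) * (fact (suc n) * logCoeff x (suc n))      ≡⟨ cong (sgn n * inv! n *_) (Σ-bel-*-S₂ x n) ⟨
    (sgn n * inv! n) * Σ1 (suc n) (λ k → bel k x * S₂ (suc n) k) ∎
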